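{- Let $\mathcal A=\langle Q,d,T_u,T_f,T_s,\emptyset\rangle$ be an ABVASS, $q_r\in Q$, $\vec v_0\in\mathbb N^d$, and $Q_\ell\subseteq Q$. If $\mathcal A$ has a $(q_r,\vec v_0)$-rooted $Q_\ell$-leaf-covering deduction tree, then it has such a deduction tree of height at most $H(d,|Q|,\max^-(T_u))$.
   Context: An ABVASS is $\mathcal A=\langle Q,d,T_u,T_f,T_s,\emptyset\rangle$ with finite state set $Q$, dimension $d\in\mathbb N$, finite unary rules $T_u\subseteq Q\times\mathbb Z^d\times Q$, fork rules $T_f\subseteq Q^3$, split rules $T_s\subseteq Q^3$. A deduction tree is a finite tree labelled by configurations $(q,\vec v)\in Q\times\mathbb N^d$ where each internal node with its children matches: (unary) $(q,\vec v)$ with single child $(q_1,\vec v+\vec u)$ for $(q,\vec u,q_1)\in T_u$, $\vec v+\vec u\in\mathbb N^d$; (fork) $(q,\vec v)$ with children $(q_1,\vec v),(q_2,\vec v)$ for $(q,q_1,q_2)\in T_f$; (split) $(q,\vec v_1+\vec v_2)$ with children $(q_1,\vec v_1),(q_2,\vec v_2)$ for $(q,q_1,q_2)\in T_s$. A deduction tree is $(q_r,\vec v_0)$-rooted if its root is labelled $(q_r,\vec v_0)$; $Q_\ell$-leaf-covering if every leaf label $(q,\vec v)$ has $q\in Q_\ell$ (the vector is arbitrary); its height is the maximum number of edges on a root-to-leaf path. $\max^-(T_u)$ is the largest absolute value of a negative integer occurring in a vector of $T_u$ (0 if none). For integers $d,m\ge0$, $s\ge1$: $H(0,s,m)=s$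 and $H(d+1,s,m)=s\,(m\cdot2^{H(d,s,m)})^{d+1}+H(d,s,m)$. -}

module Defs where

open import Data.Nat using (ℕ; zero; suc; _+_; _*_; _^_; _⊔_; _≤_)
open import Data.Integer as ℤ using (ℤ; +_; -[1+_])
open import Data.Fin using (Fin)
open import Data.Vec using (Vec; map; zipWith; foldr)
open import Data.List as List using (List)
open import Data.List.Membership.Propositional using (_∈_)
open import Data.Product using (_×_; _,_)
open import Data.Unit using (⊤)
open import Relation.Binary.PropositionalEquality using (_≡_)

-- An ABVASS with state set Q = Fin n (so |Q| = n), dimension d,
-- unary, fork and split rules (the last component ∅ is omitted).
record ABVASS (n d : ℕ) : Set where
  field
    Tu : List (Fin n × Vec ℤ d × Fin n)
    Tf : List (Fin n × Fin n × Fin n)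
    Ts : List (Fin n × Fin n × Fin n)

open ABVASS public

toℤ : ∀ {d} → Vec ℕ d → Vec ℤ d
toℤ = map (λ k → + k)

_+ᵥ_ : ∀ {d} → Vec ℕ d → Vec ℕ d → Vec ℕ d
_+ᵥ_ = zipWith _+_

_+ᶻ_ : ∀ {d} → Vec ℤ d → Vec ℤ d → Vec ℤ d
_+ᶻ_ = zipWith ℤ._+_

data DTree {n d : ℕ} (A : ABVASS n d) : Fin n → Vec ℕ d → Set where
  leaf  : ∀ q v → DTree A q v
  unary : ∀ {q q₁ u v} (w : Vec ℕ d) → (q , u , q₁) ∈ Tu A →
          toℤ v +ᶻ u ≡ toℤ w → DTree A q₁ w → DTree A q v
  fork  : ∀ {q q₁ q₂ v} → (q , q₁ , q₂) ∈ Tf A →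
          DTree A q₁ v → DTree A q₂ v → DTree A q v
  split : ∀ {q q₁ q₂} (v₁ v₂ : Vec ℕ d) → (q , q₁ , q₂) ∈ Ts A →
          DTree A q₁ v₁ → DTree A q₂ v₂ → DTree A q (v₁ +ᵥ v₂)

height : ∀ {n d} {A : ABVASS n d} {q v} → DTree A q v → ℕ
height (leaf _ _)        = 0
height (unary _ _ _ t)   = suc (height t)
height (fork _ t₁ t₂)    = suc (height t₁ ⊔ height t₂)
height (split _ _ _ t₁ t₂) = suc (height t₁ ⊔ height t₂)

LeafCovering : ∀ {n d} {A : ABVASS n d} → (Fin n → Set) → ∀ {q v} → DTree A q v → Set
LeafCovering Qℓ (leaf q _)          = Qℓ q
LeafCovering Qℓ (unary _ _ _ t)     = LeafCovering Qℓ t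
LeafCovering Qℓ (fork _ t₁ t₂)      = LeafCovering Qℓ t₁ × LeafCovering Qℓ t₂
LeafCovering Qℓ (split _ _ _ t₁ t₂) = LeafCovering Qℓ t₁ × LeafCovering Qℓ t₂

negPart : ℤ → ℕ
negPart (+ _)    = 0
negPart -[1+ k ] = suc k

-- max⁻(T_u): largest |x| over negative entries x of vectors in T_u (0 if none)
maxNeg : ∀ {n d} → ABVASS n d → ℕ
maxNeg A = List.foldr (λ { (_ , u , _) m → foldr _ (λ x k → negPart x ⊔ k) 0 u ⊔ m }) 0 (Tu A)

H : ℕ → ℕ → ℕ → ℕ
H zero    s m = s
H (suc d) s m = s * (m * 2 ^ H d s m) ^ suc d + H d s m

-- Induction on the dimension d. Put B = m 2^H(d-1, |Q|, m) and call a configuration small if all its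
-- coordinates are below B. A configuration with a coordinate i ≥ B has a tree of height ≤ H(d-1):
-- delete coordinate i, shorten the tree in dimension d-1 to some height h ≤ H(d-1), and put the
-- coordinate back, which is possible as any value ≥ m 2^h suffices (a unary step consumes at most
-- m, a split gives m 2^(h-1) to each child). Above such configurations, repetitions of small
-- configurations on a branch are cut out by replacing the subtree at the upper occurrence by the
-- one at the lower occurrence, so a branch meets at most |Q| B^d small configurations.
module Submission where

open import Defs
open import Data.Nat using (ℕ; zero; suc; _+_; _*_; _^_; _⊔_; _<_; _∸_; _≤_; z≤n; s≤s; _≤?_)
open import Data.Nat.Properties
open import Data.Integer as ℤ using (ℤ; +_; -[1+_])
open import Data.Integer.Properties using (⊖-≥)
open import Data.Fin as Fin using (Fin; punchIn)
open import Data.Vec as Vec using (Vec; []; _∷_; lookup; insertAt; removeAt; zipWith)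
open import Data.Vec.Properties using (map-insertAt; insertAt-removeAt) renaming (≡-dec to ≡-decᵥ)
open import Data.Vec.Relation.Unary.All using (All; []; _∷_)
open import Data.List as List using (List; length; filter; upTo; allFin; cartesianProduct; cartesianProductWith)
open import Data.List.Properties using (length-++; length-map; length-upTo; length-tabulate; filter-notAll)
open import Data.List.Membership.Propositional using (_∈_; _∉_)
open import Data.List.Membership.Propositional.Properties
  using (∈-map⁺; ∈-map⁻; ∈-upTo⁺; ∈-allFin; ∈-cartesianProductWith⁺; ∈-cartesianProduct⁺; ∈-filter⁺)
open import Data.List.Relation.Unary.Any as Any using (here; there)
open import Data.Product using (Σ; _×_; ∃; _,_)
open import Data.Product.Properties using (≡-dec)
open import Data.Sum using (_⊎_; inj₁; inj₂)
open import Relation.Nullary using (Dec; yes; no; ¬?; contradiction)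
open import Relation.Binary.Definitions using (DecidableEquality)
open import Relation.Binary.PropositionalEquality
  using (_≡_; _≢_; refl; sym; trans; cong; cong₂; subst; module ≡-Reasoning)

removeAt-map : ∀ {A B : Set} {k} (f : A → B) (xs : Vec A (suc k)) i →
               removeAt (Vec.map f xs) i ≡ Vec.map f (removeAt xs i)
removeAt-map f (x ∷ xs)         Fin.zero    = refl
removeAt-map f (x ∷ xs@(_ ∷ _)) (Fin.suc i) = cong (f x ∷_) (removeAt-map f xs i)

removeAt-zipWith : ∀ {A B C : Set} {k} (f : A → B → C) (xs : Vec A (suc k)) ys i →
                   removeAt (zipWith f xs ys) i ≡ zipWith f (removeAt xs i) (removeAt ys i)
removeAt-zipWith f (x ∷ xs)         (y ∷ ys)         Fin.zero    = refl
removeAt-zipWith f (x ∷ xs@(_ ∷ _)) (y ∷ ys@(_ ∷ _)) (Fin.suc i) =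
  cong (f x y ∷_) (removeAt-zipWith f xs ys i)

insertAt-zipWith : ∀ {A B C : Set} {k} (f : A → B → C) (xs : Vec A k) ys i x y →
                   insertAt (zipWith f xs ys) i (f x y) ≡ zipWith f (insertAt xs i x) (insertAt ys i y)
insertAt-zipWith f xs        ys        Fin.zero    x y = refl
insertAt-zipWith f (x′ ∷ xs) (y′ ∷ ys) (Fin.suc i) x y = cong (f x′ y′ ∷_) (insertAt-zipWith f xs ys i x y)

lookup-removeAt : ∀ {A : Set} {k} (xs : Vec A (suc k)) i j → lookup (removeAt xs i) j ≡ lookup xs (punchIn i j)
lookup-removeAt (x ∷ xs)     Fin.zero    j           = refl
lookup-removeAt (x ∷ y ∷ xs) (Fin.suc i) Fin.zero    = refl
lookup-removeAt (x ∷ y ∷ xs) (Fin.suc i) (Fin.suc j) = lookup-removeAt (y ∷ xs) i j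

length-cartesianProductWith : ∀ {A B C : Set} (f : A → B → C) xs ys →
                              length (cartesianProductWith f xs ys) ≡ length xs * length ys
length-cartesianProductWith f List.[]       ys = refl
length-cartesianProductWith f (x List.∷ xs) ys =
  trans (length-++ (List.map (f x) ys))
        (cong₂ _+_ (length-map (f x) ys) (length-cartesianProductWith f xs ys))

vecsBelow : ℕ → ∀ k → List (Vec ℕ k)
vecsBelow B zero    = [] List.∷ List.[]
vecsBelow B (suc k) = cartesianProductWith _∷_ (upTo B) (vecsBelow B k)

length-vecsBelow : ∀ B k → length (vecsBelow B k) ≡ B ^ k
length-vecsBelow B zero    = refl
length-vecsBelow B (suc k) =
  trans (length-cartesianProductWith _∷_ (upTo B) (vecsBelow B k))
        (cong₂ _*_ (length-upTo B) (length-vecsBelow B k))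

∈-vecsBelow : ∀ {B k} {v : Vec ℕ k} → All (_< B) v → v ∈ vecsBelow B k
∈-vecsBelow []          = here refl
∈-vecsBelow (x<B ∷ v<B) = ∈-cartesianProductWith⁺ _∷_ (∈-upTo⁺ x<B) (∈-vecsBelow v<B)

below-or-reaching : ∀ B {k} (v : Vec ℕ k) → All (_< B) v ⊎ ∃ λ i → B ≤ lookup v i
below-or-reaching B []      = inj₁ []
below-or-reaching B (x ∷ v) with B ≤? x | below-or-reaching B v
... | yes B≤x | _               = inj₂ (Fin.zero , B≤x)
... | no  _   | inj₂ (i , B≤vᵢ) = inj₂ (Fin.suc i , B≤vᵢ)
... | no  B≰x | inj₁ v<B        = inj₁ (≰⇒> B≰x ∷ v<B)

*2^-monoʳ-≤ : ∀ m {h h′} → h ≤ h′ → m * 2 ^ h ≤ m * 2 ^ h′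
*2^-monoʳ-≤ m h≤h′ = *-monoʳ-≤ m (^-monoʳ-≤ 2 h≤h′)

*2^-suc : ∀ m h → m * 2 ^ suc h ≡ m * 2 ^ h + m * 2 ^ h
*2^-suc m h = trans (cong (λ z → m * (2 ^ h + z)) (+-identityʳ (2 ^ h))) (*-distribˡ-+ m (2 ^ h) (2 ^ h))

m≤m*2^h : ∀ m h → m ≤ m * 2 ^ h
m≤m*2^h m h = m≤m*n m (2 ^ h) {{m^n≢0 2 h}}

*2^-budget-unary : ∀ m h {x y a} → m * 2 ^ suc h ≤ x → x ≤ y + a → a ≤ m → m * 2 ^ h ≤ y
*2^-budget-unary m h {x} {y} {a} x≥ x≤y+a a≤m = +-cancelʳ-≤ m (m * 2 ^ h) y (begin
  m * 2 ^ h + m          ≤⟨ +-monoʳ-≤ (m * 2 ^ h) (m≤m*2^h m h) ⟩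
  m * 2 ^ h + m * 2 ^ h  ≡⟨ *2^-suc m h ⟨
  m * 2 ^ suc h          ≤⟨ x≥ ⟩
  x                      ≤⟨ x≤y+a ⟩
  y + a                  ≤⟨ +-monoʳ-≤ y a≤m ⟩
  y + m                  ∎)
  where open ≤-Reasoning

+-negPart : ∀ x a → negPart a ≤ x → ∃ λ y → + x ℤ.+ a ≡ + y × x ≤ y + negPart a
+-negPart x (+ k)    _    = x + k , refl , ≤-trans (m≤m+n x k) (≤-reflexive (sym (+-identityʳ (x + k))))
+-negPart x -[1+ k ] k<x = x ∸ suc k , ⊖-≥ k<x , ≤-reflexive (sym (m∸n+n≡m k<x))

Shallow : ∀ {n d} → ABVASS n d → (Fin n → Set) → ℕ → Fin n → Vec ℕ d → Set
Shallow A Qℓ h q v = Σ (DTree A q v) λ t → LeafCovering Qℓ t × height t ≤ h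

weakenShallow : ∀ {n d} {A : ABVASS n d} {Qℓ h h′ q v} →
                h ≤ h′ → Shallow A Qℓ h q v → Shallow A Qℓ h′ q v
weakenShallow h≤h′ (t , lc , t≤h) = t , lc , ≤-trans t≤h h≤h′

NegBounded : ∀ {n d} → ℕ → ABVASS n d → Set
NegBounded m A = ∀ {q u q′} → (q , u , q′) ∈ Tu A → ∀ i → negPart (lookup u i) ≤ m

negPart-lookup≤ : ∀ {k} (u : Vec ℤ k) i →
                  negPart (lookup u i) ≤ Vec.foldr _ (λ x r → negPart x ⊔ r) 0 u
negPart-lookup≤ (a ∷ u) Fin.zero    = m≤m⊔n _ _
negPart-lookup≤ (a ∷ u) (Fin.suc i) = ≤-trans (negPart-lookup≤ u i) (m≤n⊔m _ _)

maxNeg-negBounded : ∀ {n d} (A : ABVASS n d) → NegBounded (maxNeg A) A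
maxNeg-negBounded A = bounded (Tu A)
  where
  bounded : ∀ rules → NegBounded (maxNeg (record A { Tu = rules })) (record A { Tu = rules })
  bounded (_ List.∷ rules) {u = u} (here refl) i = ≤-trans (negPart-lookup≤ u i) (m≤m⊔n _ _)
  bounded (_ List.∷ rules) (there mem) i = ≤-trans (bounded rules mem i) (m≤n⊔m _ _)

projectRule : ∀ {n d} → Fin (suc d) → Fin n × Vec ℤ (suc d) × Fin n → Fin n × Vec ℤ d × Fin n
projectRule i (q , u , q′) = q , removeAt u i , q′

project : ∀ {n d} → Fin (suc d) → ABVASS n (suc d) → ABVASS n d
project i A = record { Tu = List.map (projectRule i) (Tu A) ; Tf = Tf A ; Ts = Ts A }

project-negBounded : ∀ {n d m} {A : ABVASS n (suc d)} i → NegBounded m A → NegBounded m (project i A)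
project-negBounded i bound mem j with ∈-map⁻ (projectRule i) mem
... | (_ , u , _) , mem′ , refl =
  subst (λ a → negPart a ≤ _) (sym (lookup-removeAt u i j)) (bound mem′ (punchIn i j))

toℤ-removeAt : ∀ {d} {v w : Vec ℕ (suc d)} {u} i → toℤ v +ᶻ u ≡ toℤ w →
               toℤ (removeAt v i) +ᶻ removeAt u i ≡ toℤ (removeAt w i)
toℤ-removeAt {v = v} {w} {u} i e = begin
  toℤ (removeAt v i) +ᶻ removeAt u i   ≡⟨ cong (_+ᶻ removeAt u i) (removeAt-map +_ v i) ⟨
  removeAt (toℤ v) i +ᶻ removeAt u i   ≡⟨ removeAt-zipWith ℤ._+_ (toℤ v) u i ⟨
  removeAt (toℤ v +ᶻ u) i              ≡⟨ cong (λ z → removeAt z i) e ⟩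
  removeAt (toℤ w) i                   ≡⟨ removeAt-map +_ w i ⟩
  toℤ (removeAt w i)                   ∎
  where open ≡-Reasoning

toℤ-insertAt : ∀ {d} {w w′ : Vec ℕ d} {u : Vec ℤ (suc d)} {x y} i →
               toℤ w +ᶻ removeAt u i ≡ toℤ w′ → + x ℤ.+ lookup u i ≡ + y →
               toℤ (insertAt w i x) +ᶻ u ≡ toℤ (insertAt w′ i y)
toℤ-insertAt {w = w} {w′} {u} {x} {y} i e exy = begin
  toℤ (insertAt w i x) +ᶻ u
    ≡⟨ cong₂ _+ᶻ_ (map-insertAt +_ x w i) (sym (insertAt-removeAt u i)) ⟩
  insertAt (toℤ w) i (+ x) +ᶻ insertAt (removeAt u i) i (lookup u i)
    ≡⟨ insertAt-zipWith ℤ._+_ (toℤ w) (removeAt u i) i (+ x) (lookup u i) ⟨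
  insertAt (toℤ w +ᶻ removeAt u i) i (+ x ℤ.+ lookup u i)
    ≡⟨ cong₂ (λ z a → insertAt z i a) e exy ⟩
  insertAt (toℤ w′) i (+ y)
    ≡⟨ map-insertAt +_ y w′ i ⟨
  toℤ (insertAt w′ i y) ∎
  where open ≡-Reasoning

insertAt-+ᵥ : ∀ {d} (w₁ w₂ : Vec ℕ d) i {c x} → c ≤ x →
              insertAt (w₁ +ᵥ w₂) i x ≡ insertAt w₁ i c +ᵥ insertAt w₂ i (x ∸ c)
insertAt-+ᵥ w₁ w₂ i c≤x =
  trans (cong (insertAt (w₁ +ᵥ w₂) i) (sym (m+[n∸m]≡n c≤x))) (insertAt-zipWith _+_ w₁ w₂ i _ _)

module _ {n d} {A : ABVASS n (suc d)} (Qℓ : Fin n → Set) (i : Fin (suc d)) where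

  projectTree : ∀ {q v} (t : DTree A q v) → LeafCovering Qℓ t →
                Σ (DTree (project i A) q (removeAt v i)) (LeafCovering Qℓ)
  projectTree (leaf q v) lc = leaf q (removeAt v i) , lc
  projectTree (unary w mem e t) lc =
    let (t′ , lc′) = projectTree t lc
    in unary (removeAt w i) (∈-map⁺ (projectRule i) mem) (toℤ-removeAt i e) t′ , lc′
  projectTree (fork mem t₁ t₂) (lc₁ , lc₂) =
    let (t₁′ , lc₁′) = projectTree t₁ lc₁
        (t₂′ , lc₂′) = projectTree t₂ lc₂
    in fork mem t₁′ t₂′ , (lc₁′ , lc₂′)
  projectTree {q} (split v₁ v₂ mem t₁ t₂) (lc₁ , lc₂) =
    let (t₁′ , lc₁′) = projectTree t₁ lc₁
        (t₂′ , lc₂′) = projectTree t₂ lc₂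
    in subst (λ v → Σ (DTree (project i A) q v) (LeafCovering Qℓ))
             (sym (removeAt-zipWith _+_ v₁ v₂ i))
             (split (removeAt v₁ i) (removeAt v₂ i) mem t₁′ t₂′ , (lc₁′ , lc₂′))

  liftTree : ∀ {m} → NegBounded m A → ∀ {q w} x (t : DTree (project i A) q w) → LeafCovering Qℓ t →
             m * 2 ^ height t ≤ x → Shallow A Qℓ (height t) q (insertAt w i x)
  liftTree bound x (leaf q w) lc _ = leaf q (insertAt w i x) , lc , z≤n
  liftTree {m} bound x (unary w′ mem′ e t) lc x≥ with ∈-map⁻ (projectRule i) mem′
  ... | (_ , u , _) , mem , refl =
    let uᵢ≤m = bound mem i
        (y , x+uᵢ≡y , x≤y+uᵢ) =
          +-negPart x (lookup u i) (≤-trans uᵢ≤m (≤-trans (m≤m*2^h m (suc (height t))) x≥))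
        (t′ , lc′ , t′≤t) = liftTree bound y t lc (*2^-budget-unary m (height t) x≥ x≤y+uᵢ uᵢ≤m)
    in unary (insertAt w′ i y) mem (toℤ-insertAt i e x+uᵢ≡y) t′ , lc′ , s≤s t′≤t
  liftTree {m} bound x (fork mem t₁ t₂) (lc₁ , lc₂) x≥ =
    let (t₁′ , lc₁′ , b₁) = liftTree bound x t₁ lc₁ (below (m≤m⊔n (height t₁) _))
        (t₂′ , lc₂′ , b₂) = liftTree bound x t₂ lc₂ (below (m≤n⊔m _ (height t₂)))
    in fork mem t₁′ t₂′ , (lc₁′ , lc₂′) , s≤s (⊔-mono-≤ b₁ b₂)
    where
    below : ∀ {h} → h ≤ height t₁ ⊔ height t₂ → m * 2 ^ h ≤ x
    below h≤ = ≤-trans (*2^-monoʳ-≤ m (m≤n⇒m≤1+n h≤)) x≥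
  liftTree {m} bound {q} x (split w₁ w₂ mem t₁ t₂) (lc₁ , lc₂) x≥ =
    let (t₁′ , lc₁′ , b₁) = liftTree bound c t₁ lc₁ (below (m≤m⊔n (height t₁) _))
        (t₂′ , lc₂′ , b₂) =
          liftTree bound (x ∸ c) t₂ lc₂ (≤-trans (below (m≤n⊔m _ (height t₂))) (m+n≤o⇒m≤o∸n c c+c≤x))
    in subst (Shallow A Qℓ _ q) (sym (insertAt-+ᵥ w₁ w₂ i (m+n≤o⇒m≤o c c+c≤x)))
             (split _ _ mem t₁′ t₂′ , (lc₁′ , lc₂′) , s≤s (⊔-mono-≤ b₁ b₂))
    where
    c : ℕ
    c = m * 2 ^ (height t₁ ⊔ height t₂)
    c+c≤x : c + c ≤ x
    c+c≤x = subst (_≤ x) (*2^-suc m (height t₁ ⊔ height t₂)) x≥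
    below : ∀ {h} → h ≤ height t₁ ⊔ height t₂ → m * 2 ^ h ≤ c
    below = *2^-monoʳ-≤ m

module Cutting {n d} (A : ABVASS n d) (Qℓ : Fin n → Set) (B k : ℕ)
  (shortenLarge : ∀ {q v} i → B ≤ lookup v i → (t : DTree A q v) → LeafCovering Qℓ t →
                  Shallow A Qℓ k q v)
  where

  Config : Set
  Config = Fin n × Vec ℕ d

  _≟ᶜ_ : DecidableEquality Config
  _≟ᶜ_ = ≡-dec Fin._≟_ (≡-decᵥ _≟_)

  open import Data.List.Membership.DecPropositional _≟ᶜ_ using (_∈?_)

  smallConfigs : List Config
  smallConfigs = cartesianProduct (allFin n) (vecsBelow B d)

  length-smallConfigs : length smallConfigs ≡ n * B ^ d
  length-smallConfigs = trans (length-cartesianProductWith _,_ (allFin n) (vecsBelow B d))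
                              (cong₂ _*_ (length-tabulate {n = n} (λ q → q)) (length-vecsBelow B d))

  _≢?_ : ∀ c′ c → Dec (c′ ≢ c)
  c′ ≢? c = ¬? (c′ ≟ᶜ c)

  remove : Config → List Config → List Config
  remove c = filter (_≢? c)

  length-remove : ∀ {c R} → c ∈ R → suc (length (remove c R)) ≤ length R
  length-remove {c} c∈R =
    filter-notAll (_≢? c) _ (Any.map (λ c≡c′ c′≢c → c′≢c (sym c≡c′)) c∈R)

  ∉-remove : ∀ {c c′ R} → c′ ∉ remove c R → c′ ≢ c → c′ ∉ R
  ∉-remove c′∉ c′≢c c′∈R = c′∉ (∈-filter⁺ (_≢? _) c′∈R c′≢c)

  -- R lists the small configurations not yet met on the path from the root. A `repeated` outcome
  -- hands back, for a configuration met higher up, a tree no higher than the current subtree.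
  data Outcome (R : List Config) (q : Fin n) (v : Vec ℕ d) (h : ℕ) : Set where
    shortened : Shallow A Qℓ (length R + k) q v → Outcome R q v h
    repeated  : ∀ {q′ v′} → (q′ , v′) ∈ smallConfigs → (q′ , v′) ∉ R → Shallow A Qℓ h q′ v′ →
                Outcome R q v h

  weakenOutcome : ∀ {R q v h h′} → h ≤ h′ → Outcome R q v h → Outcome R q v h′
  weakenOutcome h≤h′ (shortened s)      = shortened s
  weakenOutcome h≤h′ (repeated c∈ c∉ s) = repeated c∈ c∉ (weakenShallow h≤h′ s)

  mutual
    shorten : ∀ f R {q v} (t : DTree A q v) → LeafCovering Qℓ t → height t ≤ f →
              Outcome R q v (height t)
    shorten f R {q} {v} t lc t≤f with below-or-reaching B v
    ... | inj₂ (i , B≤vᵢ) = shortened (weakenShallow (m≤n+m k (length R)) (shortenLarge i B≤vᵢ t lc))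
    ... | inj₁ v<B with (q , v) ∈? R
    ...   | no  c∉R = repeated (∈-cartesianProduct⁺ (∈-allFin q) (∈-vecsBelow v<B)) c∉R (t , lc , ≤-refl)
    ...   | yes c∈R = shortenBelow f R c∈R t lc t≤f

    shortenBelow : ∀ f R {q v} → (q , v) ∈ R → (t : DTree A q v) → LeafCovering Qℓ t → height t ≤ f →
                   Outcome R q v (height t)
    shortenBelow f R c∈R (leaf q v) lc _ = shortened (leaf q v , lc , z≤n)
    shortenBelow f R c∈R (unary w mem e t₁) lc t≤f =
      descend f R t₁ lc ≤-refl t≤f λ (t₁′ , lc₁′ , b₁) →
      shortened (unary w mem e t₁′ , lc₁′ , extend c∈R b₁)
    shortenBelow f R c∈R (fork mem t₁ t₂) (lc₁ , lc₂) t≤f =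
      descend f R t₁ lc₁ (s≤s (m≤m⊔n _ _)) t≤f λ (t₁′ , lc₁′ , b₁) →
      descend f R t₂ lc₂ (s≤s (m≤n⊔m _ _)) t≤f λ (t₂′ , lc₂′ , b₂) →
      shortened (fork mem t₁′ t₂′ , (lc₁′ , lc₂′) , extend c∈R (⊔-lub b₁ b₂))
    shortenBelow f R c∈R (split v₁ v₂ mem t₁ t₂) (lc₁ , lc₂) t≤f =
      descend f R t₁ lc₁ (s≤s (m≤m⊔n _ _)) t≤f λ (t₁′ , lc₁′ , b₁) →
      descend f R t₂ lc₂ (s≤s (m≤n⊔m _ _)) t≤f λ (t₂′ , lc₂′ , b₂) →
      shortened (split v₁ v₂ mem t₁′ t₂′ , (lc₁′ , lc₂′) , extend c∈R (⊔-lub b₁ b₂))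

    -- A child returning a tree for the current configuration itself restarts the search on that
    -- strictly lower tree.
    descend : ∀ f R {q v q₁ v₁ h} (t₁ : DTree A q₁ v₁) → LeafCovering Qℓ t₁ →
              height t₁ < h → h ≤ f →
              (Shallow A Qℓ (length (remove (q , v) R) + k) q₁ v₁ → Outcome R q v h) → Outcome R q v h
    descend zero    R t₁ lc₁ t₁<h h≤0 _ = contradiction (<-≤-trans t₁<h h≤0) n≮0
    descend (suc f) R {q} {v} t₁ lc₁ t₁<h h≤1+f continue
      with shorten f (remove (q , v) R) t₁ lc₁ (≤-pred (<-≤-trans t₁<h h≤1+f))
    ... | shortened s = continue s
    ... | repeated {q′} {v′} c′∈ c′∉ s′ with (q′ , v′) ≟ᶜ (q , v)
    ...   | no  c′≢c = repeated c′∈ (∉-remove c′∉ c′≢c) (weakenShallow (<⇒≤ t₁<h) s′)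
    ...   | yes refl =
      let (t′ , lc′ , t′≤t₁) = s′
      in weakenOutcome (≤-trans t′≤t₁ (<⇒≤ t₁<h))
                       (shorten f R t′ lc′ (≤-trans t′≤t₁ (≤-pred (<-≤-trans t₁<h h≤1+f))))

    extend : ∀ {c R h} → c ∈ R → h ≤ length (remove c R) + k → suc h ≤ length R + k
    extend c∈R h≤ = ≤-trans (s≤s h≤) (+-monoˡ-≤ k (length-remove c∈R))

  shallow : ∀ {q v} (t : DTree A q v) → LeafCovering Qℓ t → Shallow A Qℓ (n * B ^ d + k) q v
  shallow t lc with shorten (height t) smallConfigs t lc ≤-refl
  ... | shortened s       = weakenShallow (≤-reflexive (cong (_+ k) length-smallConfigs)) s
  ... | repeated c∈ c∉ _ = contradiction c∈ c∉

shallowTree : ∀ {n} d (A : ABVASS n d) {m} → NegBounded m A → (Qℓ : Fin n → Set) →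
              ∀ {q v} (t : DTree A q v) → LeafCovering Qℓ t → Shallow A Qℓ (H d n m) q v
shallowTree {n} zero A _ Qℓ t lc =
  weakenShallow (≤-reflexive (trans (+-identityʳ _) (*-identityʳ n)))
                (Cutting.shallow A Qℓ 0 0 (λ ()) t lc)
shallowTree {n} (suc d) A {m} bound Qℓ t lc =
  Cutting.shallow A Qℓ (m * 2 ^ H d n m) (H d n m) shortenLarge t lc
  where
  shortenLarge : ∀ {q v} i → m * 2 ^ H d n m ≤ lookup v i → (t : DTree A q v) → LeafCovering Qℓ t →
                 Shallow A Qℓ (H d n m) q v
  shortenLarge {q} {v} i large t lc =
    let (t′ , lc′) = projectTree Qℓ i t lc
        (s , lcs , s≤H) = shallowTree d (project i A) {m} (project-negBounded {A = A} i bound) Qℓ t′ lc′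
        lifted = liftTree Qℓ i bound (lookup v i) s lcs (≤-trans (*2^-monoʳ-≤ m s≤H) large)
    in subst (Shallow A Qℓ _ q) (insertAt-removeAt v i) (weakenShallow s≤H lifted)

lemma5p1 : ∀ {n d} (A : ABVASS n d) (qr : Fin n) (v₀ : Vec ℕ d) (Qℓ : Fin n → Set) →
           Σ (DTree A qr v₀) (LeafCovering Qℓ) →
           Σ (DTree A qr v₀) (λ t → LeafCovering Qℓ t × height t ≤ H d n (maxNeg A))
lemma5p1 {d = d} A _ _ Qℓ (t , lc) = shallowTree d A (maxNeg-negBounded A) Qℓ t lc
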